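{- Let $E=\mathbb{Q}(\sqrt{ -d})$ be an imaginary quadratic field ($d$ a square-free positive integer) with ring of integers $\mathcal{O}=\mathbb{Z}+\mathbb{Z}\omega$. Let $\mathfrak{U}=\mathcal{O}k+\mathcal{O}(s+t\omega)$ be an integral ideal with $k\in\mathbb{Z}_{>0}$ and $s,t\in\mathbb{Z}$, let $r$ be a positive integer and let $L^r=\mathfrak{U}v^r$ be the unary Hermitian lattice with $h(v^r)=r/k$. Suppose $\sigma:L^r\to I_m$ is a representation with $\sigma(kv^r)=\gamma_1z_1+\cdots+\gamma_mz_m$, where $\{z_1,\dots,z_m\}$ is an orthonormal basis of $I_m$ and $\gamma_\ell=a_\ell+b_\ell\omega\in\mathcal{O}$ ($a_\ell,b_\ell\in\mathbb{Z}$). Then for each $1\leq\ell\leq m$: (1.1) if $d\equiv1,2\pmod4$, then $k\mid(sa_\ell-dtb_\ell)$ and $k\mid(ta_\ell+sb_\ell)$; (1.2) if $d\equiv3\pmod4$, then $k\mid\big(sa_\ell-\frac{1+d}{4}tb_\ell\big)$ and $k\mid(ta_\ell+(s+t)b_\ell)$.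
   Context: $\omega=\sqrt{ -d}$ if $d\equiv1,2\pmod 4$ and $\omega=(1+\sqrt{ -d})/2$ if $d\equiv3\pmod4$. A Hermitian lattice is a finitely generated $\mathcal{O}$-module in an $E$-vector space with a Hermitian form $h$ ($E$-linear in the first variable, $h(v,w)=\overline{h(w,v)}$), $h(v):=h(v,v)$. $I_m$ is the free Hermitian lattice of rank $m$ with an orthonormal basis. A representation $L\to K$ is an injective $\mathcal{O}$-linear map preserving $h$. -}

module Defs where

open import Data.Nat as ℕ using (ℕ; zero; suc)
open import Data.Nat.DivMod using (_%_; _/_)
open import Data.Nat.Divisibility as ℕD using ()
open import Data.Integer as ℤ using (ℤ; +_; -_)
open import Data.Fin using (Fin; zero; suc)
open import Data.Product using (Σ; ∃; _×_; _,_)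
open import Relation.Binary.PropositionalEquality using (_≡_)

SquareFree : ℕ → Set
SquareFree d = ∀ (p : ℕ) → (p ℕ.* p) ℕD.∣ d → p ≡ 1

record 𝒪 : Set where
  constructor _+_ω
  field
    re : ℤ
    im : ℤ
open 𝒪 public

-- Arithmetic in 𝒪 for E = ℚ(√-d), d square-free positive.
-- ω = √-d when d ≡ 1,2 (mod 4): ω² = -d, ω̄ = -ω.
-- ω = (1+√-d)/2 when d ≡ 3 (mod 4): ω² = ω - (1+d)/4, ω̄ = 1 - ω.
-- Uniformly: ω² = p + qω and ω̄ = q - ω.
module Ring (d : ℕ) where

  ωp : ℤ
  ωp with d % 4
  ... | 3 = - (+ ((1 ℕ.+ d) / 4))
  ... | _ = - (+ d)

  ωq : ℤ
  ωq with d % 4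
  ... | 3 = + 1
  ... | _ = + 0

  ι : ℤ → 𝒪
  ι a = a + + 0 ω

  0O : 𝒪
  0O = ι (+ 0)

  _+O_ : 𝒪 → 𝒪 → 𝒪
  (a + b ω) +O (c + e ω) = (a ℤ.+ c) + (b ℤ.+ e) ω

  _*O_ : 𝒪 → 𝒪 → 𝒪
  (a + b ω) *O (c + e ω) =
    (a ℤ.* c ℤ.+ b ℤ.* e ℤ.* ωp) + (a ℤ.* e ℤ.+ b ℤ.* c ℤ.+ b ℤ.* e ℤ.* ωq) ω

  -- complex conjugation: conj (a + bω) = a + b ω̄ = (a + b q) - b ω
  conj : 𝒪 → 𝒪
  conj (a + b ω) = (a ℤ.+ b ℤ.* ωq) + (- b) ω

  sumO : ∀ {m} → (Fin m → 𝒪) → 𝒪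
  sumO {zero} f = 0O
  sumO {suc m} f = f zero +O sumO (λ i → f (suc i))

  -- The free Hermitian lattice I_m = 𝒪^m with orthonormal basis z_1..z_m:
  -- a vector Σ c_ℓ z_ℓ is represented by its coordinates c : Fin m → 𝒪.
  Iₘ : ℕ → Set
  Iₘ m = Fin m → 𝒪

  _+I_ : ∀ {m} → Iₘ m → Iₘ m → Iₘ m
  (x +I y) i = x i +O y i

  _·I_ : ∀ {m} → 𝒪 → Iₘ m → Iₘ m
  (c ·I x) i = c *O x i

  hI : ∀ {m} → Iₘ m → Iₘ m → 𝒪
  hI x y = sumO (λ i → x i *O conj (y i))

  In𝔘 : (k s t : ℤ) → 𝒪 → Set
  In𝔘 k s t α = Σ 𝒪 λ x → Σ 𝒪 λ y → α ≡ (x *O ι k) +O (y *O (s + t ω))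

  -- The element α v^r of L^r (α ∈ 𝔘) is represented by α, and
  -- σ α _ gives the coordinates of σ(α v^r) in the basis z_1..z_m.
  -- h(α v^r, β v^r) = α β̄ r / k; preservation of h is stated after
  -- multiplying both sides by k (so it is an identity in 𝒪).
  record Representation (k s t : ℤ) (r m : ℕ) : Set where
    field
      σ : (α : 𝒪) → In𝔘 k s t α → Iₘ m
      linear : ∀ (c α β : 𝒪) (pα : In𝔘 k s t α) (pβ : In𝔘 k s t β)
                 (p : In𝔘 k s t ((c *O α) +O β)) →
               σ ((c *O α) +O β) p ≡ (c ·I σ α pα) +I σ β pβ
      injective : ∀ (α β : 𝒪) (pα : In𝔘 k s t α) (pβ : In𝔘 k s t β) →
                  (∀ i → σ α pα i ≡ σ β pβ i) → α ≡ β
      preserves-h : ∀ (α β : 𝒪) (pα : In𝔘 k s t α) (pβ : In𝔘 k s t β) →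
                    ι k *O hI (σ α pα) (σ β pβ) ≡ ι (+ r) *O (α *O conj β)

-- Since σ is 𝒪-linear, u σ(v) = v σ(u) for all u, v ∈ 𝔘: both equal σ(u v).
-- Taking u = s + tω and v = k gives (s + tω) γ_ℓ = k σ(s + tω)_ℓ, so k divides
-- both coordinates of (s + tω) γ_ℓ, which are the two expressions of the theorem
-- once ω² = ωp + ωq ω is substituted.
module Submission where

open import Defs
open import Data.Nat as ℕ using (ℕ)
open import Data.Nat.DivMod using (_%_; _/_)
open import Data.Integer as ℤ using (ℤ; +_; _-_; -_)
open import Data.Integer.Properties
  using (*-comm; *-identityˡ; +-identityˡ; +-0-abelianGroup; +-commutativeSemigroup)
open import Data.Integer.Divisibility using (_∣_)
import Data.Integer as Int
import Data.Integer.Divisibility.Signed as Signed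
open import Data.Integer.Tactic.RingSolver using (solve; solve-∀)
open import Algebra.Properties.AbelianGroup +-0-abelianGroup using (∙-cancelʳ)
open import Algebra.Properties.CommutativeSemigroup +-commutativeSemigroup
  using () renaming (interchange to +-interchange)
open import Data.Fin using (Fin)
open import Data.List using (_∷_; [])
open import Data.Product using (_×_; _,_; proj₁; proj₂)
open import Data.Sum using (_⊎_; inj₁; inj₂)
open import Relation.Binary.PropositionalEquality
open ≡-Reasoning

infix 4 _∣𝒪_
_∣𝒪_ : ℤ → 𝒪 → Set
n ∣𝒪 x = n ∣ re x × n ∣ im x

n∣n*m : ∀ n m → n ∣ n ℤ.* m
n∣n*m n m = Signed.∣⇒∣ᵤ (Signed.divides m (*-comm n m))

x+y*z*-n≡x-n*y*z : ∀ x y z n → x ℤ.+ y ℤ.* z ℤ.* - n ≡ x - n ℤ.* y ℤ.* z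
x+y*z*-n≡x-n*y*z = solve-∀

module _ (d : ℕ) where
  open Ring d

  +O-identityˡ : ∀ x → 0O +O x ≡ x
  +O-identityˡ (a + b ω) = cong₂ _+_ω (+-identityˡ a) (+-identityˡ b)

  +O-interchange : ∀ x y z w → (x +O y) +O (z +O w) ≡ (x +O z) +O (y +O w)
  +O-interchange (a + b ω) (c + e ω) (f + g ω) (h + i ω) =
    cong₂ _+_ω (+-interchange a c f h) (+-interchange b e g i)

  +O-cancelʳ : ∀ {x y} z → x +O z ≡ y +O z → x ≡ y
  +O-cancelʳ {a + b ω} {c + e ω} (f + g ω) eq =
    cong₂ _+_ω (∙-cancelʳ f a c (cong re eq)) (∙-cancelʳ g b e (cong im eq))

  -- The ring solver only accepts variables as atoms, so ωp and ωq are
  -- abstracted to p and q in the component identities below.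
  *O-comm : ∀ x y → x *O y ≡ y *O x
  *O-comm (a + b ω) (c + e ω) = cong₂ _+_ω (re≡ ωp) (im≡ ωq)
    where
    open Int using (_+_; _*_)
    re≡ : ∀ p → a * c + b * e * p ≡ c * a + e * b * p
    re≡ p = solve (a ∷ b ∷ c ∷ e ∷ p ∷ [])
    im≡ : ∀ q → a * e + b * c + b * e * q ≡ c * b + e * a + e * b * q
    im≡ q = solve (a ∷ b ∷ c ∷ e ∷ q ∷ [])

  *O-assoc : ∀ x y z → (x *O y) *O z ≡ x *O (y *O z)
  *O-assoc (a + b ω) (c + e ω) (f + g ω) = cong₂ _+_ω (re≡ ωp ωq) (im≡ ωp ωq)
    where
    open Int using (_+_; _*_)
    re≡ : ∀ p q → (a * c + b * e * p) * f + (a * e + b * c + b * e * q) * g * p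
                ≡ a * (c * f + e * g * p) + b * (c * g + e * f + e * g * q) * p
    re≡ p q = solve (a ∷ b ∷ c ∷ e ∷ f ∷ g ∷ p ∷ q ∷ [])
    im≡ : ∀ p q → (a * c + b * e * p) * g + (a * e + b * c + b * e * q) * f
                    + (a * e + b * c + b * e * q) * g * q
                ≡ a * (c * g + e * f + e * g * q) + b * (c * f + e * g * p)
                    + b * (c * g + e * f + e * g * q) * q
    im≡ p q = solve (a ∷ b ∷ c ∷ e ∷ f ∷ g ∷ p ∷ q ∷ [])

  *O-distribˡ-+O : ∀ x y z → x *O (y +O z) ≡ (x *O y) +O (x *O z)
  *O-distribˡ-+O (a + b ω) (c + e ω) (f + g ω) = cong₂ _+_ω (re≡ ωp) (im≡ ωq)
    where
    open Int using (_+_; _*_)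
    re≡ : ∀ p → a * (c + f) + b * (e + g) * p ≡ (a * c + b * e * p) + (a * f + b * g * p)
    re≡ p = solve (a ∷ b ∷ c ∷ e ∷ f ∷ g ∷ p ∷ [])
    im≡ : ∀ q → a * (e + g) + b * (c + f) + b * (e + g) * q
              ≡ (a * e + b * c + b * e * q) + (a * g + b * f + b * g * q)
    im≡ q = solve (a ∷ b ∷ c ∷ e ∷ f ∷ g ∷ q ∷ [])

  *O-distribʳ-+O : ∀ x y z → (y +O z) *O x ≡ (y *O x) +O (z *O x)
  *O-distribʳ-+O x y z = begin
    (y +O z) *O x        ≡⟨ *O-comm (y +O z) x ⟩
    x *O (y +O z)        ≡⟨ *O-distribˡ-+O x y z ⟩
    (x *O y) +O (x *O z) ≡⟨ cong₂ _+O_ (*O-comm x y) (*O-comm x z) ⟩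
    (y *O x) +O (z *O x) ∎

  ι-*O : ∀ n x → ι n *O x ≡ (n ℤ.* re x) + (n ℤ.* im x) ω
  ι-*O n (a + b ω) = cong₂ _+_ω (re≡ ωp) (im≡ ωq)
    where
    open Int using (_+_; _*_)
    re≡ : ∀ p → n * a + + 0 * b * p ≡ n * a
    re≡ p = solve (n ∷ a ∷ b ∷ p ∷ [])
    im≡ : ∀ q → n * b + + 0 * a + + 0 * b * q ≡ n * b
    im≡ q = solve (n ∷ a ∷ b ∷ q ∷ [])

  *O-identityˡ : ∀ x → ι (+ 1) *O x ≡ x
  *O-identityˡ x =
    trans (ι-*O (+ 1) x) (cong₂ _+_ω (*-identityˡ (re x)) (*-identityˡ (im x)))

  *O-zeroˡ : ∀ x → 0O *O x ≡ 0O
  *O-zeroˡ x = ι-*O (+ 0) x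

  ι-∣𝒪 : ∀ n x → n ∣𝒪 (ι n *O x)
  ι-∣𝒪 n x = subst (n ∣𝒪_) (sym (ι-*O n x)) (n∣n*m n (re x) , n∣n*m n (im x))

  𝔘-closed : ∀ {k s t} c {α β} → In𝔘 k s t α → In𝔘 k s t β → In𝔘 k s t ((c *O α) +O β)
  𝔘-closed {k} {s} {t} c (x , y , refl) (x′ , y′ , refl) =
    ((c *O x) +O x′) , ((c *O y) +O y′) , (begin
      (c *O ((x *O K) +O (y *O g))) +O ((x′ *O K) +O (y′ *O g))
        ≡⟨ cong (_+O ((x′ *O K) +O (y′ *O g))) (*O-distribˡ-+O c (x *O K) (y *O g)) ⟩
      ((c *O (x *O K)) +O (c *O (y *O g))) +O ((x′ *O K) +O (y′ *O g))
        ≡⟨ cong (_+O ((x′ *O K) +O (y′ *O g)))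
                (cong₂ _+O_ (sym (*O-assoc c x K)) (sym (*O-assoc c y g))) ⟩
      (((c *O x) *O K) +O ((c *O y) *O g)) +O ((x′ *O K) +O (y′ *O g))
        ≡⟨ +O-interchange ((c *O x) *O K) ((c *O y) *O g) (x′ *O K) (y′ *O g) ⟩
      (((c *O x) *O K) +O (x′ *O K)) +O (((c *O y) *O g) +O (y′ *O g))
        ≡⟨ cong₂ _+O_ (sym (*O-distribʳ-+O K (c *O x) x′))
                      (sym (*O-distribʳ-+O g (c *O y) y′)) ⟩
      (((c *O x) +O x′) *O K) +O (((c *O y) +O y′) *O g) ∎)
    where
    K g : 𝒪
    K = ι k
    g = s + t ω

  generator-∈𝔘 : ∀ {k s t} → In𝔘 k s t (s + t ω)
  generator-∈𝔘 {k} {s} {t} = 0O , ι (+ 1) , sym (begin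
    (0O *O ι k) +O (ι (+ 1) *O (s + t ω))
      ≡⟨ cong₂ _+O_ (*O-zeroˡ (ι k)) (*O-identityˡ (s + t ω)) ⟩
    0O +O (s + t ω)
      ≡⟨ +O-identityˡ (s + t ω) ⟩
    s + t ω ∎)

  module _ {k s t : ℤ} {r m : ℕ} (R : Representation k s t r m) where
    open Representation R

    σ-subst : ∀ {x y} (x≡y : x ≡ y) (px : In𝔘 k s t x) →
              σ x px ≡ σ y (subst (In𝔘 k s t) x≡y px)
    σ-subst refl px = refl

    -- linear only evaluates σ on elements c α + β, hence the detour through
    -- u v + v = v u + v and a final cancellation.
    σ-swap : ∀ u v (pu : In𝔘 k s t u) (pv : In𝔘 k s t v) (ℓ : Fin m) →
             u *O σ v pv ℓ ≡ v *O σ u pu ℓ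
    σ-swap u v pu pv ℓ = +O-cancelʳ (σ v pv ℓ) (begin
      (u *O σ v pv ℓ) +O σ v pv ℓ          ≡⟨ cong-app (linear u v v pv pv puv+v) ℓ ⟨
      σ ((u *O v) +O v) puv+v ℓ           ≡⟨ cong-app (σ-subst uv+v≡vu+v puv+v) ℓ ⟩
      σ ((v *O u) +O v) pvu+v ℓ           ≡⟨ cong-app (linear v u v pu pv pvu+v) ℓ ⟩
      (v *O σ u pu ℓ) +O σ v pv ℓ          ∎)
      where
      puv+v : In𝔘 k s t ((u *O v) +O v)
      puv+v = 𝔘-closed u pv pv
      uv+v≡vu+v : (u *O v) +O v ≡ (v *O u) +O v
      uv+v≡vu+v = cong (_+O v) (*O-comm u v)
      pvu+v : In𝔘 k s t ((v *O u) +O v)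
      pvu+v = subst (In𝔘 k s t) uv+v≡vu+v puv+v

    generator-*O-∣𝒪 : (pk : In𝔘 k s t (ι k)) (ℓ : Fin m) → k ∣𝒪 ((s + t ω) *O σ (ι k) pk ℓ)
    generator-*O-∣𝒪 pk ℓ =
      subst (k ∣𝒪_) (sym (σ-swap (s + t ω) (ι k) generator-∈𝔘 pk ℓ))
            (ι-∣𝒪 k (σ (s + t ω) generator-∈𝔘 ℓ))

  ω²-d%4≡1⊎2 : d % 4 ≡ 1 ⊎ d % 4 ≡ 2 → ωp ≡ - (+ d) × ωq ≡ + 0
  ω²-d%4≡1⊎2 (inj₁ h) rewrite h = refl , refl
  ω²-d%4≡1⊎2 (inj₂ h) rewrite h = refl , refl

  ω²-d%4≡3 : d % 4 ≡ 3 → ωp ≡ - (+ ((1 ℕ.+ d) / 4)) × ωq ≡ + 1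
  ω²-d%4≡3 h rewrite h = refl , refl

  -- The divisibility hypotheses below are about the two coordinates of
  -- (s + tω) (a + bω), written out so that ωp and ωq can be rewritten.
  module _ (n s t a b : ℤ) where
    open Int using (_+_; _*_)

    ∣-coordinates-d%4≡1⊎2 : d % 4 ≡ 1 ⊎ d % 4 ≡ 2 →
      n ∣ s * a + t * b * ωp → n ∣ s * b + t * a + t * b * ωq →
      n ∣ s * a - + d * t * b × n ∣ t * a + s * b
    ∣-coordinates-d%4≡1⊎2 h n∣re n∣im
      rewrite proj₁ (ω²-d%4≡1⊎2 h) | proj₂ (ω²-d%4≡1⊎2 h) =
        subst (n ∣_) (x+y*z*-n≡x-n*y*z (s * a) t b (+ d)) n∣re
      , subst (n ∣_) im≡ n∣im
      where
      im≡ : s * b + t * a + t * b * + 0 ≡ t * a + s * b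
      im≡ = solve (s ∷ t ∷ a ∷ b ∷ [])

    ∣-coordinates-d%4≡3 : d % 4 ≡ 3 →
      n ∣ s * a + t * b * ωp → n ∣ s * b + t * a + t * b * ωq →
      n ∣ s * a - + ((1 ℕ.+ d) / 4) * t * b × n ∣ t * a + (s + t) * b
    ∣-coordinates-d%4≡3 h n∣re n∣im
      rewrite proj₁ (ω²-d%4≡3 h) | proj₂ (ω²-d%4≡3 h) =
        subst (n ∣_) (x+y*z*-n≡x-n*y*z (s * a) t b (+ ((1 ℕ.+ d) / 4))) n∣re
      , subst (n ∣_) im≡ n∣im
      where
      im≡ : s * b + t * a + t * b * + 1 ≡ t * a + (s + t) * b
      im≡ = solve (s ∷ t ∷ a ∷ b ∷ [])

lemma1 : (d : ℕ) → 0 ℕ.< d → SquareFree d →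
         (k : ℕ) → 0 ℕ.< k → (s t : ℤ) → (r : ℕ) → 0 ℕ.< r → (m : ℕ) →
         (R : Ring.Representation d (+ k) s t r m) →
         (γ : Fin m → 𝒪) →
         (pk : Ring.In𝔘 d (+ k) s t (Ring.ι d (+ k))) →
         (∀ ℓ → Ring.Representation.σ R (Ring.ι d (+ k)) pk ℓ ≡ γ ℓ) →
         ∀ (ℓ : Fin m) →
           ((d % 4 ≡ 1 ⊎ d % 4 ≡ 2) →
              ((+ k) ∣ (s ℤ.* re (γ ℓ) - (+ d) ℤ.* t ℤ.* im (γ ℓ)))
            × ((+ k) ∣ (t ℤ.* re (γ ℓ) ℤ.+ s ℤ.* im (γ ℓ))))
         × (d % 4 ≡ 3 →
              ((+ k) ∣ (s ℤ.* re (γ ℓ) - (+ ((1 ℕ.+ d) / 4)) ℤ.* t ℤ.* im (γ ℓ)))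
            × ((+ k) ∣ (t ℤ.* re (γ ℓ) ℤ.+ (s ℤ.+ t) ℤ.* im (γ ℓ))))
lemma1 d _ _ k _ s t r _ m R γ pk σk≡γ ℓ =
    (λ h → ∣-coordinates-d%4≡1⊎2 d (+ k) s t a b h (proj₁ k∣γ) (proj₂ k∣γ))
  , (λ h → ∣-coordinates-d%4≡3 d (+ k) s t a b h (proj₁ k∣γ) (proj₂ k∣γ))
  where
  open Ring d using (_*O_)
  a b : ℤ
  a = re (γ ℓ)
  b = im (γ ℓ)
  k∣γ : + k ∣𝒪 ((s + t ω) *O γ ℓ)
  k∣γ = subst (λ x → + k ∣𝒪 ((s + t ω) *O x)) (σk≡γ ℓ) (generator-*O-∣𝒪 d R pk ℓ)
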